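{- For $n\ge 1$ let $$f_n(x,y,z) := \sum_{\pi\in S_n} x^{{\rm inv}(\pi)}\, y^{{\rm maj}(\pi)}\, z^{{\rm last}(\pi)}.$$ Then $f_1(x,y,z)=1$ and, for every $n\ge 2$, $$(x-z)\,f_n(x,y,z) = (x^{n}y^{n-1} - z^{n})\, f_{n-1}(x,y,1) + x^{n-1}(1-y^{n-1})\, z\, f_{n-1}(x,y,z/x),$$ as an identity of Laurent polynomials in $x,y,z$.
   Context: $S_n$ is the symmetric group on $\{1,\dots,n\}$, permutations written in one-line notation $(\pi(1),\dots,\pi(n))$. ${\rm inv}(\pi)=\#\{(i,j): i<j,\ \pi(i)>\pi(j)\}$ is the inversion number; ${\rm maj}(\pi)=\sum\{\,i : 1\le i\le n-1,\ \pi(i)>\pi(i+1)\,\}$ is the major index; ${\rm last}(\pi):=\pi(n)-1$. -}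

module Defs where

open import Data.Nat using (ℕ; zero; suc; _+_; _∸_; _<ᵇ_; _≡ᵇ_)
open import Data.Integer as ℤ using (ℤ; +_)
open import Data.Bool using (Bool; true; false; if_then_else_; _∧_; not)
open import Data.List using (List; []; _∷_; map; concatMap; filter; _++_; foldr)
open import Data.Product using (_×_; _,_)
open import Relation.Binary.PropositionalEquality using (_≡_)
open import Relation.Nullary.Decidable using (⌊_⌋)

-- Laurent polynomials in x, y, z with integer coefficients, represented
-- as formal finite sums of monomials  c · x^a y^b z^d  (a, b, d ∈ ℤ).
-- Two such sums are equal as Laurent polynomials iff all their
-- coefficients agree.

record Mono : Set where
  constructor mono
  field
    coef : ℤ
    ex ey ez : ℤ

LPoly : Set
LPoly = List Mono

coeff : LPoly → ℤ → ℤ → ℤ → ℤ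
coeff [] a b d = + 0
coeff (mono c ea eb ed ∷ p) a b d =
  (if ⌊ ea ℤ.≟ a ⌋ ∧ ⌊ eb ℤ.≟ b ⌋ ∧ ⌊ ed ℤ.≟ d ⌋ then c else + 0) ℤ.+ coeff p a b d

_≈ₚ_ : LPoly → LPoly → Set
p ≈ₚ q = ∀ a b d → coeff p a b d ≡ coeff q a b d

infix 4 _≈ₚ_

_+ₚ_ : LPoly → LPoly → LPoly
p +ₚ q = p ++ q

monoMul : Mono → Mono → Mono
monoMul (mono c a b d) (mono c' a' b' d') = mono (c ℤ.* c') (a ℤ.+ a') (b ℤ.+ b') (d ℤ.+ d')

_*ₚ_ : LPoly → LPoly → LPoly
p *ₚ q = concatMap (λ m → map (monoMul m) q) p

infixl 6 _+ₚ_
infixl 7 _*ₚ_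

oneₚ : LPoly
oneₚ = mono (+ 1) (+ 0) (+ 0) (+ 0) ∷ []

subZ1 : LPoly → LPoly
subZ1 = map (λ { (mono c a b d) → mono c a b (+ 0) })

subZoverX : LPoly → LPoly
subZoverX = map (λ { (mono c a b d) → mono c (a ℤ.- d) b d })

words : ℕ → ℕ → List (List ℕ)
words zero    k = [] ∷ []
words (suc n) k = concatMap (λ w → map (λ i → suc i ∷ w) (range k)) (words n k)
  where
  range : ℕ → List ℕ
  range zero    = []
  range (suc m) = m ∷ range m

elemᵇ : ℕ → List ℕ → Bool
elemᵇ a []      = false
elemᵇ a (b ∷ w) = if a ≡ᵇ b then true else elemᵇ a w

distinctᵇ : List ℕ → Bool
distinctᵇ []      = true
distinctᵇ (a ∷ w) = not (elemᵇ a w) ∧ distinctᵇ w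

perms : ℕ → List (List ℕ)
perms n = filter (λ w → Data.Bool._≟_ (distinctᵇ w) true) (words n n)

countLess : ℕ → List ℕ → ℕ
countLess a []      = 0
countLess a (b ∷ w) = (if b <ᵇ a then 1 else 0) + countLess a w

inv : List ℕ → ℕ
inv []      = 0
inv (a ∷ w) = countLess a w + inv w

majFrom : ℕ → List ℕ → ℕ
majFrom i []           = 0
majFrom i (a ∷ [])     = 0
majFrom i (a ∷ b ∷ w)  = (if b <ᵇ a then i else 0) + majFrom (suc i) (b ∷ w)

maj : List ℕ → ℕ
maj = majFrom 1

lastv : List ℕ → ℕ
lastv []          = 0
lastv (a ∷ [])    = a ∸ 1
lastv (a ∷ b ∷ w) = lastv (b ∷ w)

f : ℕ → LPoly
f n = map (λ π → mono (+ 1) (+ inv π) (+ maj π) (+ lastv π)) (perms n)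

xMinusZ : LPoly
xMinusZ = mono (+ 1) (+ 1) (+ 0) (+ 0) ∷ mono (ℤ.- + 1) (+ 0) (+ 0) (+ 1) ∷ []

coefA : ℕ → LPoly
coefA n = mono (+ 1) (+ n) (+ (n ∸ 1)) (+ 0) ∷ mono (ℤ.- + 1) (+ 0) (+ 0) (+ n) ∷ []

coefB : ℕ → LPoly
coefB n = mono (+ 1) (+ (n ∸ 1)) (+ 0) (+ 1) ∷ mono (ℤ.- + 1) (+ (n ∸ 1)) (+ (n ∸ 1)) (+ 1) ∷ []

-- Every permutation of [1..m+1] arises exactly once from a permutation σ of
-- [1..m] and a k ∈ [0..m] by raising the values above k by one and appending
-- k+1.  This adds m - k inversions, adds the descent position m to maj exactly
-- when k < σ(m), and makes last = k.  So (x - z) f_{m+1} is a sum over σ of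
-- x^inv(σ) y^maj(σ) Σ_k (x - z) x^(m-k) y^(m[k < σ(m)]) z^k, and since
-- z · x^(e-k) z^k = x · x^(e-k-1) z^(k+1) the inner sum telescopes separately
-- over k < σ(m) and k ≥ σ(m), leaving the four monomials of the right-hand side.
module Submission where

open import Defs
open import Data.Bool using (Bool; true; false; if_then_else_; T; _∧_)
import Data.Bool as Bool
open import Data.Empty using (⊥-elim)
open import Data.Integer as ℤ using (ℤ; +_)
import Data.Integer.Properties as ℤP
open import Data.Integer.Tactic.RingSolver using (solve-∀)
open import Data.List
  using (List; []; _∷_; [_]; _++_; _∷ʳ_; map; concat; concatMap; length; applyUpTo; upTo; downFrom;
         cartesianProductWith; initLast; _∷ʳ′_)
import Data.List.Properties as List
open import Data.List.Membership.Propositional using (_∈_; _∉_)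
open import Data.List.Membership.Propositional.Properties
  using (∈-map⁻; ∈-filter⁺; ∈-filter⁻; ∈-cartesianProductWith⁺; ∈-cartesianProductWith⁻;
         ∈-downFrom⁺; ∈-downFrom⁻; ∈-upTo⁺; ∈-upTo⁻)
open import Data.List.Membership.Propositional.Properties.WithK using (unique∧set⇒bag)
open import Data.List.Relation.Binary.BagAndSetEquality using (∼bag⇒↭)
open import Data.List.Relation.Binary.Permutation.Propositional as ↭
  using (_↭_; ↭-refl; ↭-prep; ↭-trans; ↭-sym; ↭-reflexive)
open import Data.List.Relation.Binary.Permutation.Propositional.Properties using (++⁺; ++⁺ˡ; shifts; ↭-reverse)
open import Data.List.Relation.Unary.All as All using (All; []; _∷_)
import Data.List.Relation.Unary.All.Properties as All
open import Data.List.Relation.Unary.Any using (here; there)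
open import Data.List.Relation.Unary.Unique.Propositional using (Unique; []; _∷_)
import Data.List.Relation.Unary.Unique.Propositional.Properties as Unique
open import Data.Nat using (ℕ; zero; suc; pred; _+_; _∸_; _<_; _≤_; _≤?_; _<ᵇ_; _≡ᵇ_; z≤n; s≤s; z<s)
import Data.Nat.Properties as ℕ
open import Data.Product using (_×_; _,_; ∃₂)
open import Data.Unit using (tt)
open import Function using (_∘_; mk⇔)
open import Relation.Binary.Bundles using (Setoid)
open import Relation.Binary.Definitions using (tri<; tri≈; tri>)
open import Relation.Binary.PropositionalEquality hiding ([_])
open import Relation.Binary.Structures using (IsEquivalence)
open import Relation.Nullary using (¬_; yes; no)
open import Relation.Nullary.Decidable using (⌊_⌋)
open import Relation.Nullary.Reflects using (Reflects; ofʸ; ofⁿ; det; fromEquivalence)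

open import Algebra.Properties.CommutativeSemigroup ℕ.+-commutativeSemigroup using (interchange)
open import Algebra.Properties.CommutativeSemigroup ℤP.+-commutativeSemigroup using (x∙yz≈y∙xz)

module _ {A : Set} where

  length-∷ʳ : ∀ (xs : List A) x → length (xs ∷ʳ x) ≡ suc (length xs)
  length-∷ʳ xs x = trans (List.length-++ xs) (ℕ.+-comm (length xs) 1)

  Unique-∷ʳ⁻ : ∀ (xs : List A) {x} → Unique (xs ∷ʳ x) → Unique xs × x ∉ xs
  Unique-∷ʳ⁻ []       _             = [] , λ ()
  Unique-∷ʳ⁻ (y ∷ xs) (y∉ ∷ unique) with y∉xs , y≢x ← All.∷ʳ⁻ y∉ | unique′ , x∉xs ← Unique-∷ʳ⁻ xs unique =
    y∉xs ∷ unique′ , λ where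
      (here refl)  → y≢x refl
      (there x∈xs) → x∉xs x∈xs

  applyUpTo-+ : ∀ (f : ℕ → A) a b → applyUpTo f (a + b) ≡ applyUpTo f a ++ applyUpTo (λ i → f (a + i)) b
  applyUpTo-+ f zero    b = refl
  applyUpTo-+ f (suc a) b = cong (f 0 ∷_) (applyUpTo-+ (f ∘ suc) a b)

  applyUpTo-cong : ∀ {f g : ℕ → A} n → (∀ {i} → i < n → f i ≡ g i) → applyUpTo f n ≡ applyUpTo g n
  applyUpTo-cong zero    f≡g = refl
  applyUpTo-cong (suc n) f≡g = cong₂ _∷_ (f≡g z<s) (applyUpTo-cong n (f≡g ∘ s≤s))

  ++-interchange : ∀ (p q r s : List A) → (p ++ q) ++ (r ++ s) ↭ (p ++ r) ++ (q ++ s)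
  ++-interchange p q r s = begin
    (p ++ q) ++ (r ++ s)  ≡⟨ List.++-assoc p q (r ++ s) ⟩
    p ++ (q ++ (r ++ s))  ↭⟨ ++⁺ˡ p (shifts q r) ⟩
    p ++ (r ++ (q ++ s))  ≡⟨ List.++-assoc p r (q ++ s) ⟨
    (p ++ r) ++ (q ++ s)  ∎
    where open ↭.PermutationReasoning

module _ {A B : Set} where

  map≡concatMap : ∀ (h : A → B) xs → map h xs ≡ concatMap (λ x → [ h x ]) xs
  map≡concatMap h []       = refl
  map≡concatMap h (x ∷ xs) = cong (h x ∷_) (map≡concatMap h xs)

  concatMap-↭ : ∀ (f : A → List B) {xs ys} → xs ↭ ys → concatMap f xs ↭ concatMap f ys
  concatMap-↭ f ↭.refl                = ↭-refl
  concatMap-↭ f (↭.prep x xs↭ys)      = ++⁺ˡ (f x) (concatMap-↭ f xs↭ys)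
  concatMap-↭ f (↭.swap x y xs↭ys)    =
    ↭-trans (shifts (f x) (f y)) (++⁺ˡ (f y) (++⁺ˡ (f x) (concatMap-↭ f xs↭ys)))
  concatMap-↭ f (↭.trans xs↭ys ys↭zs) = ↭-trans (concatMap-↭ f xs↭ys) (concatMap-↭ f ys↭zs)

  concatMap-split : ∀ (f g : A → List B) xs →
                    concatMap (λ x → f x ++ g x) xs ↭ concatMap f xs ++ concatMap g xs
  concatMap-split f g []       = ↭-refl
  concatMap-split f g (x ∷ xs) =
    ↭-trans (++⁺ˡ (f x ++ g x) (concatMap-split f g xs)) (++-interchange (f x) (g x) _ _)

module _ {A B C : Set} (f : A → B → C) where

  concatMap-map≡cartesianProductWith : ∀ xs ys → concatMap (λ x → map (f x) ys) xs ≡ cartesianProductWith f xs ys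
  concatMap-map≡cartesianProductWith []       ys = refl
  concatMap-map≡cartesianProductWith (x ∷ xs) ys = cong (map (f x) ys ++_) (concatMap-map≡cartesianProductWith xs ys)

  concatMap-cartesianProductWith : ∀ {D : Set} (g : C → List D) xs ys →
    concatMap g (cartesianProductWith f xs ys) ≡ concatMap (λ x → concatMap (g ∘ f x) ys) xs
  concatMap-cartesianProductWith g []       ys = refl
  concatMap-cartesianProductWith g (x ∷ xs) ys = begin
    concatMap g (map (f x) ys ++ cartesianProductWith f xs ys)               ≡⟨ List.concatMap-++ g (map (f x) ys) _ ⟩
    concatMap g (map (f x) ys) ++ concatMap g (cartesianProductWith f xs ys) ≡⟨ cong₂ _++_ (List.concatMap-map g (f x) ys)
                                                                                           (concatMap-cartesianProductWith g xs ys) ⟩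
    concatMap (g ∘ f x) ys ++ concatMap (λ x → concatMap (g ∘ f x) ys) xs    ∎
    where open ≡-Reasoning

infix 4 _≃_

-- `_≈ₚ_` unfolds to a function type from which Agda cannot recover the two
-- polynomials; wrapping it in a record keeps them inferable.
record _≃_ (p q : LPoly) : Set where
  constructor coeffwise
  field coeff-≡ : p ≈ₚ q

≃-isEquivalence : IsEquivalence _≃_
≃-isEquivalence = record
  { refl  = coeffwise λ a b d → refl
  ; sym   = λ (coeffwise p≈q) → coeffwise λ a b d → sym (p≈q a b d)
  ; trans = λ (coeffwise p≈q) (coeffwise q≈r) → coeffwise λ a b d → trans (p≈q a b d) (q≈r a b d)
  }

≃-setoid : Setoid _ _
≃-setoid = record { isEquivalence = ≃-isEquivalence }

open IsEquivalence ≃-isEquivalence using () renaming (refl to ≃-refl; trans to ≃-trans)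

coeffₘ : Mono → ℤ → ℤ → ℤ → ℤ
coeffₘ (mono c ea eb ed) a b d = if ⌊ ea ℤ.≟ a ⌋ ∧ ⌊ eb ℤ.≟ b ⌋ ∧ ⌊ ed ℤ.≟ d ⌋ then c else + 0

coeff-++ : ∀ p q a b d → coeff (p ++ q) a b d ≡ coeff p a b d ℤ.+ coeff q a b d
coeff-++ []      q a b d = sym (ℤP.+-identityˡ _)
coeff-++ (t ∷ p) q a b d = begin
  coeffₘ t a b d ℤ.+ coeff (p ++ q) a b d               ≡⟨ cong (λ r → coeffₘ t a b d ℤ.+ r) (coeff-++ p q a b d) ⟩
  coeffₘ t a b d ℤ.+ (coeff p a b d ℤ.+ coeff q a b d)  ≡⟨ ℤP.+-assoc (coeffₘ t a b d) (coeff p a b d) (coeff q a b d) ⟨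
  coeffₘ t a b d ℤ.+ coeff p a b d ℤ.+ coeff q a b d    ∎
  where open ≡-Reasoning

++-cong : ∀ {p p′ q q′} → p ≃ p′ → q ≃ q′ → p ++ q ≃ p′ ++ q′
++-cong {p} {p′} {q} {q′} (coeffwise p≈p′) (coeffwise q≈q′) = coeffwise λ a b d → begin
  coeff (p ++ q) a b d               ≡⟨ coeff-++ p q a b d ⟩
  coeff p a b d ℤ.+ coeff q a b d    ≡⟨ cong₂ ℤ._+_ (p≈p′ a b d) (q≈q′ a b d) ⟩
  coeff p′ a b d ℤ.+ coeff q′ a b d  ≡⟨ coeff-++ p′ q′ a b d ⟨
  coeff (p′ ++ q′) a b d             ∎
  where open ≡-Reasoning

∷-cong : ∀ t {p q} → p ≃ q → t ∷ p ≃ t ∷ q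
∷-cong t = ++-cong (≃-refl {[ t ]})

↭⇒≃ : ∀ {p q} → p ↭ q → p ≃ q
↭⇒≃ ↭.refl              = ≃-refl
↭⇒≃ (↭.prep t p↭q)      = ∷-cong t (↭⇒≃ p↭q)
↭⇒≃ (↭.swap s t p↭q)    = ≃-trans (∷-cong s (∷-cong t (↭⇒≃ p↭q))) (swap-≃ _)
  where
  swap-≃ : ∀ q → s ∷ t ∷ q ≃ t ∷ s ∷ q
  swap-≃ q = coeffwise λ a b d → x∙yz≈y∙xz (coeffₘ s a b d) (coeffₘ t a b d) (coeff q a b d)
↭⇒≃ (↭.trans p↭q q↭r)   = ≃-trans (↭⇒≃ p↭q) (↭⇒≃ q↭r)

negate : Mono → Mono
negate (mono c ea eb ed) = mono (ℤ.- c) ea eb ed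

negate-cancel : ∀ t p → negate t ∷ t ∷ p ≃ p
negate-cancel (mono c ea eb ed) p = coeffwise λ a b d →
  cancel (⌊ ea ℤ.≟ a ⌋ ∧ ⌊ eb ℤ.≟ b ⌋ ∧ ⌊ ed ℤ.≟ d ⌋) (coeff p a b d)
  where
  cancel : ∀ B r → (if B then ℤ.- c else + 0) ℤ.+ ((if B then c else + 0) ℤ.+ r) ≡ r
  cancel true  r = begin
    ℤ.- c ℤ.+ (c ℤ.+ r)  ≡⟨ ℤP.+-assoc (ℤ.- c) c r ⟨
    ℤ.- c ℤ.+ c ℤ.+ r    ≡⟨ cong (ℤ._+ r) (ℤP.+-inverseˡ c) ⟩
    + 0 ℤ.+ r            ≡⟨ ℤP.+-identityˡ r ⟩
    r                    ∎
    where open ≡-Reasoning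
  cancel false r = trans (ℤP.+-identityˡ _) (ℤP.+-identityˡ r)

*ₚ-[] : ∀ p → p *ₚ [] ≡ []
*ₚ-[] []      = refl
*ₚ-[] (t ∷ p) = *ₚ-[] p

*ₚ-++ : ∀ p q r → p *ₚ (q ++ r) ↭ p *ₚ q ++ p *ₚ r
*ₚ-++ []      q r = ↭-refl
*ₚ-++ (t ∷ p) q r = begin
  map (t ·_) (q ++ r) ++ p *ₚ (q ++ r)               ≡⟨ cong (_++ p *ₚ (q ++ r)) (List.map-++ (t ·_) q r) ⟩
  (map (t ·_) q ++ map (t ·_) r) ++ p *ₚ (q ++ r)    ↭⟨ ++⁺ˡ (map (t ·_) q ++ map (t ·_) r) (*ₚ-++ p q r) ⟩
  (map (t ·_) q ++ map (t ·_) r) ++ (p *ₚ q ++ p *ₚ r) ↭⟨ ++-interchange (map (t ·_) q) _ _ _ ⟩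
  (map (t ·_) q ++ p *ₚ q) ++ (map (t ·_) r ++ p *ₚ r) ∎
  where
  open ↭.PermutationReasoning
  _·_ = monoMul

module _ {A : Set} where

  *ₚ-concatMap : ∀ p (g : A → LPoly) xs → p *ₚ concatMap g xs ↭ concatMap (λ x → p *ₚ g x) xs
  *ₚ-concatMap p g []       = ↭-reflexive (*ₚ-[] p)
  *ₚ-concatMap p g (x ∷ xs) = ↭-trans (*ₚ-++ p (g x) (concatMap g xs)) (++⁺ˡ (p *ₚ g x) (*ₚ-concatMap p g xs))

  concatMap-cong-≃ : ∀ {g h : A → LPoly} xs → (∀ {x} → x ∈ xs → g x ≃ h x) → concatMap g xs ≃ concatMap h xs
  concatMap-cong-≃ []       g≃h = ≃-refl
  concatMap-cong-≃ (x ∷ xs) g≃h = ++-cong (g≃h (here refl)) (concatMap-cong-≃ xs (g≃h ∘ there))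

mono-cong : ∀ {c x x′ y y′ z z′} → x ≡ x′ → y ≡ y′ → z ≡ z′ → mono c x y z ≡ mono c x′ y′ z′
mono-cong refl refl refl = refl

InRange : ℕ → ℕ → Set
InRange n a = 0 < a × a ≤ n

-- `words` draws its entries from a local copy of `downFrom` that cannot be
-- named from outside; unifying against a `with`-generalised goal names it.
mutual
  localRange : ℕ → ℕ → ℕ → List ℕ
  localRange = _

  private
    words-unfold : ∀ n j → words (suc n) (suc j) ≡
                   concatMap (λ w → map (λ i → suc i ∷ w) (j ∷ localRange n (suc j) j)) (words n (suc j))
    words-unfold n j with suc j
    ... | k = refl

localRange≡downFrom : ∀ n k j → localRange n k j ≡ downFrom j
localRange≡downFrom n k zero    = refl
localRange≡downFrom n k (suc j) = cong (j ∷_) (localRange≡downFrom n k j)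

words-suc : ∀ n k → words (suc n) k ≡ cartesianProductWith (λ w i → suc i ∷ w) (words n k) (downFrom k)
words-suc n k = trans
  (cong (λ R → concatMap (λ w → map (λ i → suc i ∷ w) R) (words n k)) (localRange≡downFrom n k k))
  (concatMap-map≡cartesianProductWith (λ w i → suc i ∷ w) (words n k) (downFrom k))

∈-words⁻ : ∀ n k {w} → w ∈ words n k → length w ≡ n × All (InRange k) w
∈-words⁻ zero    k (here refl) = refl , []
∈-words⁻ (suc n) k w∈ rewrite words-suc n k
  with u , i , u∈ , i∈ , refl ← ∈-cartesianProductWith⁻ (λ w i → suc i ∷ w) (words n k) (downFrom k) w∈
  with len , inRange ← ∈-words⁻ n k u∈
  = cong suc len , (z<s , ∈-downFrom⁻ i∈) ∷ inRange

∈-words⁺ : ∀ n k {w} → length w ≡ n → All (InRange k) w → w ∈ words n k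
∈-words⁺ zero    k {[]}        refl []                    = here refl
∈-words⁺ (suc n) k {suc i ∷ w} len  ((_ , i<k) ∷ inRange) rewrite words-suc n k =
  ∈-cartesianProductWith⁺ (λ w i → suc i ∷ w) (∈-words⁺ n k (ℕ.suc-injective len) inRange) (∈-downFrom⁺ i<k)

words-unique : ∀ n k → Unique (words n k)
words-unique zero    k = [] ∷ []
words-unique (suc n) k rewrite words-suc n k =
  Unique.cartesianProductWith⁺ _ (λ { refl → refl , refl }) (words-unique n k) (Unique.downFrom⁺ k)

elemᵇ-reflects : ∀ a w → Reflects (a ∈ w) (elemᵇ a w)
elemᵇ-reflects a []      = ofⁿ λ ()
elemᵇ-reflects a (b ∷ w) with a ≡ᵇ b in a≡ᵇb | elemᵇ a w | elemᵇ-reflects a w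
... | true  | _     | _        = ofʸ (here (ℕ.≡ᵇ⇒≡ a b (subst T (sym a≡ᵇb) tt)))
... | false | true  | ofʸ a∈w = ofʸ (there a∈w)
... | false | false | ofⁿ a∉w = ofⁿ λ where
  (here refl) → subst T a≡ᵇb (ℕ.≡⇒≡ᵇ a a refl)
  (there a∈w) → a∉w a∈w

distinctᵇ-reflects : ∀ w → Reflects (Unique w) (distinctᵇ w)
distinctᵇ-reflects []      = ofʸ []
distinctᵇ-reflects (a ∷ w) with elemᵇ a w | elemᵇ-reflects a w | distinctᵇ w | distinctᵇ-reflects w
... | true  | ofʸ a∈w | _     | _      = ofⁿ λ u → Unique.Unique[x∷xs]⇒x∉xs u a∈w
... | false | ofⁿ a∉w | true  | ofʸ u  = ofʸ (All.¬Any⇒All¬ w a∉w ∷ u)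
... | false | ofⁿ _   | false | ofⁿ ¬u = ofⁿ λ where (_ ∷ u) → ¬u u

record IsPerm (n : ℕ) (w : List ℕ) : Set where
  field
    length≡ : length w ≡ n
    inRange : All (InRange n) w
    unique  : Unique w

∈-perms⁻ : ∀ n {w} → w ∈ perms n → IsPerm n w
∈-perms⁻ n {w} w∈ with w∈words , distinct ← ∈-filter⁻ (λ w → distinctᵇ w Bool.≟ true) w∈
                  with len , inRange ← ∈-words⁻ n n w∈words = record
  { length≡ = len ; inRange = inRange ; unique = fromReflects (distinctᵇ-reflects w) distinct }
  where
  fromReflects : ∀ {P b} → Reflects P b → b ≡ true → P
  fromReflects (ofʸ p) _ = p

∈-perms⁺ : ∀ n {w} → IsPerm n w → w ∈ perms n
∈-perms⁺ n {w} π = ∈-filter⁺ (λ w → distinctᵇ w Bool.≟ true)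
  (∈-words⁺ n n (IsPerm.length≡ π) (IsPerm.inRange π)) (toReflects (distinctᵇ-reflects w) (IsPerm.unique π))
  where
  toReflects : ∀ {P b} → Reflects P b → P → b ≡ true
  toReflects (ofʸ _)  _ = refl
  toReflects (ofⁿ ¬p) p = ⊥-elim (¬p p)

perms-unique : ∀ n → Unique (perms n)
perms-unique n = Unique.filter⁺ (λ w → distinctᵇ w Bool.≟ true) (words-unique n n)

bump : ℕ → ℕ → ℕ
bump k v with v ≤? k
... | yes _ = v
... | no  _ = suc v

unbump : ℕ → ℕ → ℕ
unbump k v with v ≤? k
... | yes _ = v
... | no  _ = pred v

bump-mono-< : ∀ k {a b} → a < b → bump k a < bump k b
bump-mono-< k {a} {b} a<b with a ≤? k | b ≤? k
... | yes _   | yes _   = a<b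
... | yes _   | no  _   = ℕ.m<n⇒m<1+n a<b
... | no  a≰k | yes b≤k = ⊥-elim (a≰k (ℕ.≤-trans (ℕ.<⇒≤ a<b) b≤k))
... | no  _   | no  _   = s≤s a<b

bump-cancel-< : ∀ k {a b} → bump k a < bump k b → a < b
bump-cancel-< k {a} {b} lt with ℕ.<-cmp a b
... | tri< a<b _ _  = a<b
... | tri≈ _ refl _ = ⊥-elim (ℕ.<-irrefl refl lt)
... | tri> _ _ b<a  = ⊥-elim (ℕ.<-asym lt (bump-mono-< k b<a))

bump-injective : ∀ k {a b} → bump k a ≡ bump k b → a ≡ b
bump-injective k {a} {b} eq with ℕ.<-cmp a b
... | tri< a<b _ _ = ⊥-elim (ℕ.<-irrefl eq (bump-mono-< k a<b))
... | tri≈ _ a≡b _ = a≡b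
... | tri> _ _ b<a = ⊥-elim (ℕ.<-irrefl (sym eq) (bump-mono-< k b<a))

bump-≢ : ∀ k v → bump k v ≢ suc k
bump-≢ k v eq with v ≤? k
... | yes v≤k = ℕ.<-irrefl refl (subst (_≤ k) eq v≤k)
... | no  v≰k = v≰k (ℕ.≤-reflexive (ℕ.suc-injective eq))

bump-unbump : ∀ k {v} → v ≢ suc k → bump k (unbump k v) ≡ v
bump-unbump k {v} v≢ with v ≤? k
bump-unbump k {v}     v≢ | yes v≤k with v ≤? k
... | yes _   = refl
... | no  v≰k = ⊥-elim (v≰k v≤k)
bump-unbump k {zero}  v≢ | no v≰k = ⊥-elim (v≰k z≤n)
bump-unbump k {suc v} v≢ | no v≰k with v ≤? k
... | yes v≤k = ⊥-elim (v≢ (cong suc (ℕ.≤-antisym v≤k (ℕ.≤-pred (ℕ.≰⇒> v≰k)))))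
... | no  _   = refl

bump-inRange : ∀ {m k v} → k ≤ m → InRange m v → InRange (suc m) (bump k v)
bump-inRange {k = k} {v} k≤m (0<v , v≤m) with v ≤? k
... | yes _ = 0<v , ℕ.m≤n⇒m≤1+n v≤m
... | no  _ = z<s , s≤s v≤m

unbump-inRange : ∀ {m k v} → k ≤ m → v ≢ suc k → InRange (suc m) v → InRange m (unbump k v)
unbump-inRange {k = k} {v} k≤m v≢ (0<v , v≤1+m) with v ≤? k
... | yes v≤k = 0<v , ℕ.≤-trans v≤k k≤m
unbump-inRange {k = k} {suc v} k≤m v≢ (0<v , v≤1+m) | no v≰k =
  ℕ.≤-trans (s≤s z≤n) k<v , ℕ.≤-pred v≤1+m
  where
  k<v : k < v
  k<v = ℕ.≤∧≢⇒< (ℕ.≤-pred (ℕ.≰⇒> v≰k)) (v≢ ∘ cong suc ∘ sym)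

extend : List ℕ → ℕ → List ℕ
extend σ k = map (bump k) σ ∷ʳ suc k

extend-isPerm : ∀ {m σ k} → IsPerm m σ → k ≤ m → IsPerm (suc m) (extend σ k)
extend-isPerm {m} {σ} {k} π k≤m = record
  { length≡ = trans (length-∷ʳ (map (bump k) σ) (suc k))
                    (cong suc (trans (List.length-map (bump k) σ) (IsPerm.length≡ π)))
  ; inRange = All.∷ʳ⁺ (All.map⁺ (All.map (bump-inRange k≤m) (IsPerm.inRange π))) (z<s , s≤s k≤m)
  ; unique  = Unique.++⁺ (Unique.map⁺ (bump-injective k) (IsPerm.unique π)) ([] ∷ []) disjoint
  }
  where
  disjoint : ∀ {v} → ¬ (v ∈ map (bump k) σ × v ∈ [ suc k ])
  disjoint (v∈ , here refl) with u , _ , v≡ ← ∈-map⁻ (bump k) v∈ = bump-≢ k u (sym v≡)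

extend-injective : ∀ {σ σ′ k k′} → extend σ k ≡ extend σ′ k′ → σ ≡ σ′ × k ≡ k′
extend-injective {σ} {σ′} eq with map≡ , refl ← List.∷ʳ-injective (map _ σ) (map _ σ′) eq =
  List.map-injective (bump-injective _) map≡ , refl

extend-surjective : ∀ {m w} → IsPerm (suc m) w → ∃₂ λ σ k → IsPerm m σ × k ≤ m × w ≡ extend σ k
extend-surjective {m} {w} π with initLast w
... | []      with () ← IsPerm.length≡ π
... | u ∷ʳ′ c with All.∷ʳ⁻ (IsPerm.inRange π) | Unique-∷ʳ⁻ u (IsPerm.unique π)
... | u-inRange , (0<c , c≤1+m) | u-unique , c∉u with c
... | suc k = σ , k , σ-isPerm , k≤m , cong (_∷ʳ suc k) (sym bump∘unbump≡)
  where
  k≤m = ℕ.≤-pred c≤1+m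
  σ   = map (unbump k) u
  u≢ : All (_≢ suc k) u
  u≢ = All.tabulate λ v∈u v≡ → c∉u (subst (_∈ u) v≡ v∈u)
  bump∘unbump≡ : map (bump k) σ ≡ u
  bump∘unbump≡ = trans (sym (List.map-∘ u)) (List.map-id-local (All.map (bump-unbump k) u≢))
  σ-isPerm : IsPerm m σ
  σ-isPerm = record
    { length≡ = trans (List.length-map (unbump k) u)
                      (ℕ.suc-injective (trans (sym (length-∷ʳ u (suc k))) (IsPerm.length≡ π)))
    ; inRange = All.map⁺ (All.zipWith (λ (v≢ , v∈) → unbump-inRange k≤m v≢ v∈) (u≢ , u-inRange))
    ; unique  = Unique.map⁻ (subst Unique (sym bump∘unbump≡) u-unique)
    }

perms-suc-↭ : ∀ m → perms (suc m) ↭ cartesianProductWith extend (perms m) (upTo (suc m))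
perms-suc-↭ m = ∼bag⇒↭ (unique∧set⇒bag
  (perms-unique (suc m))
  (Unique.cartesianProductWith⁺ extend extend-injective (perms-unique m) (Unique.upTo⁺ (suc m)))
  (mk⇔ to from))
  where
  to : ∀ {w} → w ∈ perms (suc m) → w ∈ cartesianProductWith extend (perms m) (upTo (suc m))
  to w∈ with σ , k , σ-isPerm , k≤m , refl ← extend-surjective (∈-perms⁻ (suc m) w∈) =
    ∈-cartesianProductWith⁺ extend (∈-perms⁺ m σ-isPerm) (∈-upTo⁺ (s≤s k≤m))
  from : ∀ {w} → w ∈ cartesianProductWith extend (perms m) (upTo (suc m)) → w ∈ perms (suc m)
  from w∈ with σ , k , σ∈ , k∈ , refl ← ∈-cartesianProductWith⁻ extend (perms m) (upTo (suc m)) w∈ =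
    ∈-perms⁺ (suc m) (extend-isPerm (∈-perms⁻ m σ∈) (ℕ.≤-pred (∈-upTo⁻ k∈)))

<ᵇ-true : ∀ {a b} → a < b → (a <ᵇ b) ≡ true
<ᵇ-true {a} {b} a<b = det (ℕ.<ᵇ-reflects-< a b) (ofʸ a<b)

<ᵇ-false : ∀ {a b} → ¬ a < b → (a <ᵇ b) ≡ false
<ᵇ-false {a} {b} a≮b = det (ℕ.<ᵇ-reflects-< a b) (ofⁿ a≮b)

<ᵇ-cong : ∀ {a b c d} → (a < b → c < d) → (c < d → a < b) → (a <ᵇ b) ≡ (c <ᵇ d)
<ᵇ-cong {a} {b} {c} {d} to from =
  det (ℕ.<ᵇ-reflects-< a b) (fromEquivalence (from ∘ ℕ.<ᵇ⇒< c d) (ℕ.<⇒<ᵇ ∘ to))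

Preserves<ᵇ : (ℕ → ℕ) → Set
Preserves<ᵇ f = ∀ a b → (f a <ᵇ f b) ≡ (a <ᵇ b)

bump-preserves<ᵇ : ∀ k → Preserves<ᵇ (bump k)
bump-preserves<ᵇ k a b = <ᵇ-cong {bump k a} {bump k b} {a} {b} (bump-cancel-< k) (bump-mono-< k)

<ᵇ-bump-low : ∀ {c k} v → c ≤ k → (c <ᵇ bump k v) ≡ (c <ᵇ v)
<ᵇ-bump-low {c} {k} v c≤k with v ≤? k
... | yes _   = refl
... | no  v≰k = <ᵇ-cong (λ _ → c<v) ℕ.m<n⇒m<1+n
  where c<v = ℕ.≤-<-trans c≤k (ℕ.≰⇒> v≰k)

<ᵇ-bump-high : ∀ {c k} v → k ≤ c → (suc c <ᵇ bump k v) ≡ (c <ᵇ v)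
<ᵇ-bump-high {c} {k} v k≤c with v ≤? k
... | yes v≤k = trans (<ᵇ-false (ℕ.≤⇒≯ (ℕ.m≤n⇒m≤1+n v≤c))) (sym (<ᵇ-false (ℕ.≤⇒≯ v≤c)))
  where v≤c = ℕ.≤-trans v≤k k≤c
... | no  _   = refl

ι : Bool → ℕ
ι b = if b then 1 else 0

countGreater : ℕ → List ℕ → ℕ
countGreater c []      = 0
countGreater c (a ∷ w) = ι (c <ᵇ a) + countGreater c w

countGreater-++ : ∀ c u v → countGreater c (u ++ v) ≡ countGreater c u + countGreater c v
countGreater-++ c []      v = refl
countGreater-++ c (a ∷ u) v = trans (cong (λ n → ι (c <ᵇ a) + n) (countGreater-++ c u v))
                                    (sym (ℕ.+-assoc (ι (c <ᵇ a)) (countGreater c u) (countGreater c v)))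

countGreater-map : ∀ {c c′} (f : ℕ → ℕ) → (∀ v → (c <ᵇ f v) ≡ (c′ <ᵇ v)) →
                   ∀ w → countGreater c (map f w) ≡ countGreater c′ w
countGreater-map f f-resp []      = refl
countGreater-map f f-resp (a ∷ w) = cong₂ _+_ (cong ι (f-resp a)) (countGreater-map f f-resp w)

countGreater-perm : ∀ {m σ} k → IsPerm m σ → countGreater k σ ≡ m ∸ k
countGreater-perm {zero}  {[]} k _ = sym (ℕ.0∸n≡0 k)
countGreater-perm {suc m}      k π
  with τ , k′ , τ-isPerm , k′≤m , refl ← extend-surjective π
  with k ≤? k′
... | yes k≤k′ = begin
  countGreater k (map (bump k′) τ ++ [ suc k′ ])                ≡⟨ countGreater-++ k (map (bump k′) τ) _ ⟩
  countGreater k (map (bump k′) τ) + countGreater k [ suc k′ ]  ≡⟨ cong₂ _+_ (countGreater-map (bump k′) (λ v → <ᵇ-bump-low v k≤k′) τ)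
                                                                            (cong (λ b → ι b + 0) (<ᵇ-true (s≤s k≤k′))) ⟩
  countGreater k τ + 1                                           ≡⟨ cong (_+ 1) (countGreater-perm k τ-isPerm) ⟩
  m ∸ k + 1                                                      ≡⟨ ℕ.+-∸-comm 1 (ℕ.≤-trans k≤k′ k′≤m) ⟨
  m + 1 ∸ k                                                      ≡⟨ cong (_∸ k) (ℕ.+-comm m 1) ⟩
  suc m ∸ k                                                      ∎
  where open ≡-Reasoning
... | no k≰k′ with ℕ.≰⇒> k≰k′
... | s≤s {n = c} k′≤c = begin
  countGreater (suc c) (map (bump k′) τ ++ [ suc k′ ])                      ≡⟨ countGreater-++ (suc c) (map (bump k′) τ) _ ⟩
  countGreater (suc c) (map (bump k′) τ) + countGreater (suc c) [ suc k′ ]  ≡⟨ cong₂ _+_ (countGreater-map (bump k′) (λ v → <ᵇ-bump-high v k′≤c) τ)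
                                                                                        (cong (λ b → ι b + 0) (<ᵇ-false (ℕ.≤⇒≯ k′≤c))) ⟩
  countGreater c τ + 0                                                       ≡⟨ ℕ.+-identityʳ _ ⟩
  countGreater c τ                                                           ≡⟨ countGreater-perm c τ-isPerm ⟩
  m ∸ c                                                                      ∎
  where open ≡-Reasoning

countLess-∷ʳ : ∀ a w c → countLess a (w ∷ʳ c) ≡ countLess a w + ι (c <ᵇ a)
countLess-∷ʳ a []      c = ℕ.+-identityʳ _
countLess-∷ʳ a (b ∷ w) c = trans (cong (λ n → ι (b <ᵇ a) + n) (countLess-∷ʳ a w c))
                                 (sym (ℕ.+-assoc (ι (b <ᵇ a)) (countLess a w) (ι (c <ᵇ a))))

countLess-map : ∀ {f} → Preserves<ᵇ f → ∀ a w → countLess (f a) (map f w) ≡ countLess a w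
countLess-map f-pres a []      = refl
countLess-map f-pres a (b ∷ w) = cong₂ _+_ (cong ι (f-pres b a)) (countLess-map f-pres a w)

inv-∷ʳ : ∀ w c → inv (w ∷ʳ c) ≡ inv w + countGreater c w
inv-∷ʳ []      c = refl
inv-∷ʳ (a ∷ w) c = trans (cong₂ _+_ (countLess-∷ʳ a w c) (inv-∷ʳ w c))
                         (interchange (countLess a w) _ (inv w) _)

inv-map : ∀ {f} → Preserves<ᵇ f → ∀ w → inv (map f w) ≡ inv w
inv-map f-pres []      = refl
inv-map f-pres (a ∷ w) = cong₂ _+_ (countLess-map f-pres a w) (inv-map f-pres w)

inv-extend : ∀ {m σ} k → IsPerm m σ → inv (extend σ k) ≡ inv σ + (m ∸ k)
inv-extend {m} {σ} k π = begin
  inv (map (bump k) σ ∷ʳ suc k)                                 ≡⟨ inv-∷ʳ (map (bump k) σ) (suc k) ⟩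
  inv (map (bump k) σ) + countGreater (suc k) (map (bump k) σ)  ≡⟨ cong₂ _+_ (inv-map (bump-preserves<ᵇ k) σ)
                                                                             (countGreater-map (bump k) (λ v → <ᵇ-bump-high v ℕ.≤-refl) σ) ⟩
  inv σ + countGreater k σ                                      ≡⟨ cong (λ n → inv σ + n) (countGreater-perm k π) ⟩
  inv σ + (m ∸ k)                                               ∎
  where open ≡-Reasoning

final : ℕ → List ℕ → ℕ
final a []      = a
final a (b ∷ w) = final b w

final-∈ : ∀ a w → final a w ∈ a ∷ w
final-∈ a []      = here refl
final-∈ a (b ∷ w) = there (final-∈ b w)

final-map : ∀ (f : ℕ → ℕ) a w → final (f a) (map f w) ≡ f (final a w)
final-map f a []      = refl
final-map f a (b ∷ w) = final-map f b w

majFrom-∷ʳ : ∀ i a w c →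
  majFrom i ((a ∷ w) ∷ʳ c) ≡ majFrom i (a ∷ w) + (if c <ᵇ final a w then length w + i else 0)
majFrom-∷ʳ i a []      c = ℕ.+-identityʳ _
majFrom-∷ʳ i a (b ∷ w) c = begin
  descent + majFrom (suc i) ((b ∷ w) ∷ʳ c)
    ≡⟨ cong (λ n → descent + n) (majFrom-∷ʳ (suc i) b w c) ⟩
  descent + (majFrom (suc i) (b ∷ w) + (if c <ᵇ final b w then length w + suc i else 0))
    ≡⟨ ℕ.+-assoc descent _ _ ⟨
  descent + majFrom (suc i) (b ∷ w) + (if c <ᵇ final b w then length w + suc i else 0)
    ≡⟨ cong (λ n → descent + majFrom (suc i) (b ∷ w) + (if c <ᵇ final b w then n else 0)) (ℕ.+-suc (length w) i) ⟩
  descent + majFrom (suc i) (b ∷ w) + (if c <ᵇ final b w then suc (length w + i) else 0)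
    ∎
  where
  open ≡-Reasoning
  descent = if b <ᵇ a then i else 0

majFrom-map : ∀ {f} → Preserves<ᵇ f → ∀ i w → majFrom i (map f w) ≡ majFrom i w
majFrom-map f-pres i []          = refl
majFrom-map f-pres i (a ∷ [])    = refl
majFrom-map f-pres i (a ∷ b ∷ w) =
  cong₂ _+_ (cong (λ b → if b then i else 0) (f-pres b a)) (majFrom-map f-pres (suc i) (b ∷ w))

maj-extend : ∀ a w k → maj (extend (a ∷ w) k) ≡ maj (a ∷ w) + (if k <ᵇ final a w then suc (length w) else 0)
maj-extend a w k = begin
  majFrom 1 ((bump k a ∷ map (bump k) w) ∷ʳ suc k)
    ≡⟨ majFrom-∷ʳ 1 (bump k a) (map (bump k) w) (suc k) ⟩
  majFrom 1 (map (bump k) (a ∷ w)) + (if suc k <ᵇ final (bump k a) (map (bump k) w) then length (map (bump k) w) + 1 else 0)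
    ≡⟨ cong₂ _+_ (majFrom-map (bump-preserves<ᵇ k) 1 (a ∷ w)) (cong₂ (λ b n → if b then n else 0) descent≡ length≡) ⟩
  maj (a ∷ w) + (if k <ᵇ final a w then suc (length w) else 0)
    ∎
  where
  open ≡-Reasoning
  descent≡ = trans (cong (suc k <ᵇ_) (final-map (bump k) a w)) (<ᵇ-bump-high (final a w) ℕ.≤-refl)
  length≡  = trans (cong (_+ 1) (List.length-map (bump k) w)) (ℕ.+-comm (length w) 1)

lastv-∷ʳ : ∀ w c → lastv (w ∷ʳ c) ≡ c ∸ 1
lastv-∷ʳ []          c = refl
lastv-∷ʳ (a ∷ [])    c = refl
lastv-∷ʳ (a ∷ b ∷ w) c = lastv-∷ʳ (b ∷ w) c

lastv-final : ∀ a w → lastv (a ∷ w) ≡ final a w ∸ 1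
lastv-final a []      = refl
lastv-final a (b ∷ w) = lastv-final b w

lastv-extend : ∀ σ k → lastv (extend σ k) ≡ k
lastv-extend σ k = lastv-∷ʳ (map (bump k) σ) (suc k)

weight : List ℕ → Mono
weight π = mono (+ 1) (+ inv π) (+ maj π) (+ lastv π)

weight-z≔1 weight-z≔z/x : List ℕ → Mono
weight-z≔1   σ = mono (+ 1) (+ inv σ) (+ maj σ) (+ 0)
weight-z≔z/x σ = mono (+ 1) (+ inv σ ℤ.- + lastv σ) (+ maj σ) (+ lastv σ)

-- Since z · term E B k = x · term E B (k+1), the products (x - z) · term E B k
-- telescope in k.
term x·term : ℤ → ℤ → ℕ → Mono
term   E B k = mono (+ 1) (E ℤ.- + k) B (+ k)
x·term E B k = mono (+ 1) (+ 1 ℤ.+ (E ℤ.- + k)) B (+ k)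

xMinusZ-*-term : ∀ E B k → xMinusZ *ₚ [ term E B k ] ≡ x·term E B k ∷ negate (x·term E B (suc k)) ∷ []
xMinusZ-*-term E B k =
  cong₂ (λ x y → mono (+ 1) (+ 1 ℤ.+ (E ℤ.- + k)) y (+ k) ∷ mono (ℤ.- + 1) x y (+ suc k) ∷ [])
        (x≡ E (+ k)) (ℤP.+-identityˡ B)
  where
  x≡ : ∀ E K → + 0 ℤ.+ (E ℤ.- K) ≡ + 1 ℤ.+ (E ℤ.- (+ 1 ℤ.+ K))
  x≡ = solve-∀

telescope : ∀ (G : ℕ → Mono) l →
            concat (applyUpTo (λ i → G i ∷ negate (G (suc i)) ∷ []) (suc l)) ≃ G 0 ∷ negate (G (suc l)) ∷ []
telescope G zero    = ≃-refl
telescope G (suc l) =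
  ∷-cong (G 0) (≃-trans (∷-cong (negate (G 1)) (telescope (G ∘ suc) l)) (negate-cancel (G 1) _))

telescope-run : ∀ E B a l (g : ℕ → LPoly) → (∀ {i} → i < suc l → g (a + i) ≡ xMinusZ *ₚ [ term E B (a + i) ]) →
  concat (applyUpTo (λ i → g (a + i)) (suc l)) ≃ x·term E B (a + 0) ∷ negate (x·term E B (a + suc l)) ∷ []
telescope-run E B a l g g≡ = begin
  concat (applyUpTo (λ i → g (a + i)) (suc l))                     ≡⟨ cong concat (applyUpTo-cong (suc l) g≡G) ⟩
  concat (applyUpTo (λ i → G i ∷ negate (G (suc i)) ∷ []) (suc l)) ≈⟨ telescope G l ⟩
  G 0 ∷ negate (G (suc l)) ∷ []                                     ∎
  where
  open import Relation.Binary.Reasoning.Setoid ≃-setoid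
  G : ℕ → Mono
  G i = x·term E B (a + i)
  g≡G : ∀ {i} → i < suc l → g (a + i) ≡ G i ∷ negate (G (suc i)) ∷ []
  g≡G {i} i< = trans (g≡ i<) (trans (xMinusZ-*-term E B (a + i))
                                    (cong (λ j → G i ∷ negate (x·term E B j) ∷ []) (sym (ℕ.+-suc a i))))

+[m∸n]≡m-n : ∀ {m n} → n ≤ m → + (m ∸ n) ≡ + m ℤ.- + n
+[m∸n]≡m-n {m} {n} n≤m = sym (trans (ℤP.m-n≡m⊖n m n) (ℤP.⊖-≥ n≤m))

weight-extend : ∀ {s a w} k → IsPerm s (a ∷ w) → k ≤ s →
  weight (extend (a ∷ w) k) ≡ term (+ (inv (a ∷ w) + s)) (+ (maj (a ∷ w) + (if k <ᵇ final a w then s else 0))) k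
weight-extend {s} {a} {w} k π k≤s = mono-cong x≡ y≡ (cong +_ (lastv-extend (a ∷ w) k))
  where
  x≡ = begin
    + inv (extend (a ∷ w) k)     ≡⟨ cong +_ (inv-extend k π) ⟩
    + (inv (a ∷ w) + (s ∸ k))    ≡⟨ cong +_ (ℕ.+-∸-assoc (inv (a ∷ w)) k≤s) ⟨
    + (inv (a ∷ w) + s ∸ k)      ≡⟨ +[m∸n]≡m-n (ℕ.≤-trans k≤s (ℕ.m≤n+m s (inv (a ∷ w)))) ⟩
    + (inv (a ∷ w) + s) ℤ.- + k  ∎
    where open ≡-Reasoning
  y≡ = cong +_ (trans (maj-extend a w k)
                      (cong (λ n → maj (a ∷ w) + (if k <ᵇ final a w then n else 0)) (IsPerm.length≡ π)))

-- σ = a ∷ w has size s = J + L + 1 and last value J + 1.  Appending k + 1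
-- creates the descent at position s exactly when k ≤ J, so the sum over k
-- telescopes separately over [0, J] and [J + 1, s].
module _ {a w} (J L : ℕ) (π : IsPerm (suc (J + L)) (a ∷ w)) (final≡ : final a w ≡ suc J) where

  private
    σ = a ∷ w
    s = suc (J + L)
    I = inv σ
    M = maj σ
    E = + (I + s)
    B₁ = + (M + s)
    B₀ = + (M + 0)

    g : ℕ → LPoly
    g k = xMinusZ *ₚ [ weight (extend σ k) ]

    g≡ : ∀ {k b} → k ≤ s → (k <ᵇ suc J) ≡ b → g k ≡ xMinusZ *ₚ [ term E (+ (M + (if b then s else 0))) k ]
    g≡ {k} k≤s k<J≡b = cong (λ t → xMinusZ *ₚ [ t ]) (trans (weight-extend k π k≤s)
      (cong (λ b → term E (+ (M + (if b then s else 0))) k) (trans (cong (k <ᵇ_) final≡) k<J≡b)))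

    rhs≡ : coefA (suc s) *ₚ [ weight-z≔1 σ ] ++ coefB (suc s) *ₚ [ weight-z≔z/x σ ] ≡
           x·term E B₁ 0 ∷ negate (x·term E B₀ (suc s)) ∷
           x·term E B₀ (suc J) ∷ negate (x·term E B₁ (suc J)) ∷ []
    rhs≡ rewrite trans (lastv-final a w) (cong (_∸ 1) final≡) =
      cong₂ _∷_ first (cong₂ _∷_ fourth (cong₂ _∷_ third (cong₂ _∷_ second refl)))
      where
      x-first : ∀ I s → (+ 1 ℤ.+ s) ℤ.+ I ≡ + 1 ℤ.+ ((I ℤ.+ s) ℤ.- + 0)
      x-first = solve-∀
      x-middle : ∀ I s J → s ℤ.+ (I ℤ.- J) ≡ + 1 ℤ.+ ((I ℤ.+ s) ℤ.- (+ 1 ℤ.+ J))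
      x-middle = solve-∀
      x-last : ∀ I s → I ≡ + 1 ℤ.+ ((I ℤ.+ s) ℤ.- (+ 1 ℤ.+ s))
      x-last = solve-∀
      first  = mono-cong (x-first (+ I) (+ s)) (cong +_ (ℕ.+-comm s M)) refl
      second = mono-cong (x-middle (+ I) (+ s) (+ J)) (cong +_ (ℕ.+-comm s M)) refl
      third  = mono-cong (x-middle (+ I) (+ s) (+ J)) (cong +_ (sym (ℕ.+-identityʳ M))) refl
      fourth = mono-cong (x-last (+ I) (+ s)) (cong +_ (sym (ℕ.+-identityʳ M))) (cong +_ (ℕ.+-identityʳ (suc s)))

  ∑-extend-split : concatMap g (upTo (suc s)) ≃
                   coefA (suc s) *ₚ [ weight-z≔1 σ ] ++ coefB (suc s) *ₚ [ weight-z≔z/x σ ]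
  ∑-extend-split = begin
    concatMap g (upTo (suc s))
      ≡⟨ cong concat (List.map-upTo g (suc s)) ⟩
    concat (applyUpTo g (suc s))
      ≡⟨ cong (concat ∘ applyUpTo g) (cong suc (ℕ.+-suc J L)) ⟨
    concat (applyUpTo g (suc J + suc L))
      ≡⟨ cong concat (applyUpTo-+ g (suc J) (suc L)) ⟩
    concat (applyUpTo g (suc J) ++ applyUpTo (λ i → g (suc J + i)) (suc L))
      ≡⟨ List.concat-++ (applyUpTo g (suc J)) _ ⟨
    concat (applyUpTo g (suc J)) ++ concat (applyUpTo (λ i → g (suc J + i)) (suc L))
      ≈⟨ ++-cong (telescope-run E B₁ 0 J g (λ i< → g≡ (below i<) (<ᵇ-true i<)))
                 (telescope-run E B₀ (suc J) L g (λ i< → g≡ (above i<) (<ᵇ-false (ℕ.≤⇒≯ (ℕ.m≤m+n (suc J) _))))) ⟩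
    x·term E B₁ 0 ∷ negate (x·term E B₁ (suc J)) ∷
      x·term E B₀ (suc J + 0) ∷ negate (x·term E B₀ (suc J + suc L)) ∷ []
      ≡⟨ cong₂ (λ i j → x·term E B₁ 0 ∷ negate (x·term E B₁ (suc J)) ∷ x·term E B₀ i ∷ negate (x·term E B₀ j) ∷ [])
               (ℕ.+-identityʳ (suc J)) (cong suc (ℕ.+-suc J L)) ⟩
    x·term E B₁ 0 ∷ negate (x·term E B₁ (suc J)) ∷
      x·term E B₀ (suc J) ∷ negate (x·term E B₀ (suc s)) ∷ []
      ≈⟨ ↭⇒≃ (↭-prep _ (↭-reverse (negate (x·term E B₀ (suc s)) ∷ x·term E B₀ (suc J) ∷
                                     negate (x·term E B₁ (suc J)) ∷ []))) ⟩
    x·term E B₁ 0 ∷ negate (x·term E B₀ (suc s)) ∷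
      x·term E B₀ (suc J) ∷ negate (x·term E B₁ (suc J)) ∷ []
      ≡⟨ rhs≡ ⟨
    coefA (suc s) *ₚ [ weight-z≔1 σ ] ++ coefB (suc s) *ₚ [ weight-z≔z/x σ ]
      ∎
    where
    open import Relation.Binary.Reasoning.Setoid ≃-setoid
    below : ∀ {i} → i < suc J → i ≤ s
    below i< = ℕ.≤-trans (ℕ.≤-pred i<) (ℕ.≤-trans (ℕ.m≤m+n J L) (ℕ.n≤1+n _))
    above : ∀ {i} → i < suc L → suc J + i ≤ s
    above i< = s≤s (ℕ.+-monoʳ-≤ J (ℕ.≤-pred i<))

∑-extend : ∀ {m σ} → IsPerm (suc m) σ →
  concatMap (λ k → xMinusZ *ₚ [ weight (extend σ k) ]) (upTo (suc (suc m))) ≃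
  coefA (suc (suc m)) *ₚ [ weight-z≔1 σ ] ++ coefB (suc (suc m)) *ₚ [ weight-z≔z/x σ ]
∑-extend {σ = []}    π with () ← IsPerm.length≡ π
∑-extend {σ = a ∷ w} π with final a w in final≡ | All.lookup (IsPerm.inRange π) (final-∈ a w)
... | suc J | _ , J<1+m with L , refl ← ℕ.m≤n⇒∃[o]m+o≡n (ℕ.≤-pred J<1+m) = ∑-extend-split J L π final≡

recurrence : ∀ m →
  xMinusZ *ₚ f (suc (suc m)) ≃ coefA (suc (suc m)) *ₚ subZ1 (f (suc m)) ++ coefB (suc (suc m)) *ₚ subZoverX (f (suc m))
recurrence m = begin
  xMinusZ *ₚ f (suc (suc m))
    ≡⟨ cong (xMinusZ *ₚ_) (map≡concatMap weight (perms (suc (suc m)))) ⟩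
  xMinusZ *ₚ concatMap (λ π → [ weight π ]) (perms (suc (suc m)))
    ≈⟨ ↭⇒≃ (*ₚ-concatMap xMinusZ _ (perms (suc (suc m)))) ⟩
  concatMap summand (perms (suc (suc m)))
    ≈⟨ ↭⇒≃ (concatMap-↭ summand (perms-suc-↭ (suc m))) ⟩
  concatMap summand (cartesianProductWith extend (perms (suc m)) (upTo (suc (suc m))))
    ≡⟨ concatMap-cartesianProductWith extend summand (perms (suc m)) (upTo (suc (suc m))) ⟩
  concatMap (λ σ → concatMap (summand ∘ extend σ) (upTo (suc (suc m)))) (perms (suc m))
    ≈⟨ concatMap-cong-≃ (perms (suc m)) (∑-extend ∘ ∈-perms⁻ (suc m)) ⟩
  concatMap (λ σ → A *ₚ [ weight-z≔1 σ ] ++ B *ₚ [ weight-z≔z/x σ ]) (perms (suc m))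
    ≈⟨ ↭⇒≃ (concatMap-split _ _ (perms (suc m))) ⟩
  concatMap (λ σ → A *ₚ [ weight-z≔1 σ ]) (perms (suc m)) ++ concatMap (λ σ → B *ₚ [ weight-z≔z/x σ ]) (perms (suc m))
    ≈⟨ ↭⇒≃ (↭-sym (++⁺ (*ₚ-concatMap A _ (perms (suc m))) (*ₚ-concatMap B _ (perms (suc m))))) ⟩
  A *ₚ concatMap (λ σ → [ weight-z≔1 σ ]) (perms (suc m)) ++ B *ₚ concatMap (λ σ → [ weight-z≔z/x σ ]) (perms (suc m))
    ≡⟨ cong₂ (λ p q → A *ₚ p ++ B *ₚ q) (weights≡ (perms (suc m))) (weights≡ (perms (suc m))) ⟨
  A *ₚ subZ1 (f (suc m)) ++ B *ₚ subZoverX (f (suc m))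
    ∎
  where
  open import Relation.Binary.Reasoning.Setoid ≃-setoid
  A = coefA (suc (suc m))
  B = coefB (suc (suc m))
  summand : List ℕ → LPoly
  summand π = xMinusZ *ₚ [ weight π ]
  weights≡ : ∀ {h : Mono → Mono} πs → map h (map weight πs) ≡ concatMap (λ π → [ h (weight π) ]) πs
  weights≡ πs = trans (sym (List.map-∘ πs)) (map≡concatMap _ πs)

theorem2p1 : (f 1 ≈ₚ oneₚ)
    × (∀ (n : ℕ) → 2 ≤ n →
        xMinusZ *ₚ f n ≈ₚ coefA n *ₚ subZ1 (f (n ∸ 1)) +ₚ coefB n *ₚ subZoverX (f (n ∸ 1)))
theorem2p1 = (λ a b d → refl) , λ where
  (suc (suc m)) _        → _≃_.coeff-≡ (recurrence m)
  (suc zero)    (s≤s ())
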